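{- Let $T$ be a tree with $n$ nodes and maximal degree $\Delta$. Then $|E_{fix}(T)|\le 2^{n-\Delta-1}$.
   Context: For a tree $T=(V,E)$, $E_{fix}(T)$ is the set of all $F\subseteq E$ with $2deg_F(v)\le deg(v)$ for every $v\in V$, where $deg_F(v)$ is the number of edges of $F$ incident to $v$ and $deg(v)$ is the degree of $v$ in $T$. -}

module Defs where

open import Data.Nat using (ℕ; zero; suc; _+_; _*_; _≤_; _≤?_)
open import Data.Bool using (Bool; true; false; _∨_; _∧_; if_then_else_)
open import Data.Fin using (Fin; zero; suc)
open import Data.Fin.Properties using (all?)
open import Data.Fin.Subset using (Subset)
open import Data.Product using (_×_; proj₁; proj₂; ∃)
open import Data.Vec using (Vec; []; _∷_; lookup)
open import Data.List using (List; []; _∷_; _++_; map; filter; length)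
open import Relation.Nullary using (Dec; ¬_; ⌊_⌋)
import Data.Fin as F
open import Relation.Binary.PropositionalEquality using (_≡_; _≢_)

record Graph (n m : ℕ) : Set where
  field ends : Fin m → Fin n × Fin n
open Graph public

incident : ∀ {n m} → Graph n m → Fin n → Fin m → Bool
incident G v i = ⌊ v F.≟ proj₁ (ends G i) ⌋ ∨ ⌊ v F.≟ proj₂ (ends G i) ⌋

count : ∀ {m} → (Fin m → Bool) → ℕ
count {zero}  p = 0
count {suc m} p = (if p zero then 1 else 0) + count (λ i → p (suc i))

deg : ∀ {n m} → Graph n m → Fin n → ℕ
deg G v = count (incident G v)

degIn : ∀ {n m} → Graph n m → Subset m → Fin n → ℕ
degIn G S v = count (λ i → lookup S i ∧ incident G v i)

data Reach {n m} (G : Graph n m) (allowed : Fin m → Set) : Fin n → Fin n → Set where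
  here : ∀ {u} → Reach G allowed u u
  fwd  : ∀ {u} i → allowed i → Reach G allowed (proj₂ (ends G i)) u →
         Reach G allowed (proj₁ (ends G i)) u
  bwd  : ∀ {u} i → allowed i → Reach G allowed (proj₁ (ends G i)) u →
         Reach G allowed (proj₂ (ends G i)) u

record ⊤' : Set where

ConnectedUsing : ∀ {n m} → Graph n m → (Fin m → Set) → Set
ConnectedUsing G allowed = ∀ u v → Reach G allowed u v

Connected : ∀ {n m} → Graph n m → Set
Connected G = ConnectedUsing G (λ _ → ⊤')

-- A tree: a nonempty, connected graph that is minimally connected
-- (deleting any edge disconnects it).  This excludes loops and parallel edges.
IsTree : ∀ {n m} → Graph n m → Set
IsTree {n} G = (1 ≤ n) × Connected G × (∀ e → ¬ ConnectedUsing G (λ i → i ≢ e))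

IsMaxDegree : ∀ {n m} → Graph n m → ℕ → Set
IsMaxDegree G Δ = (∀ v → deg G v ≤ Δ) × ∃ (λ v → deg G v ≡ Δ)

allSubsets : ∀ m → List (Subset m)
allSubsets zero    = [] ∷ []
allSubsets (suc m) = map (true ∷_) (allSubsets m) ++ map (false ∷_) (allSubsets m)

IsFix : ∀ {n m} → Graph n m → Subset m → Set
IsFix G S = ∀ v → 2 * degIn G S v ≤ deg G v

isFix? : ∀ {n m} (G : Graph n m) (S : Subset m) → Dec (IsFix G S)
isFix? G S = all? (λ v → 2 * degIn G S v ≤? deg G v)

Efix : ∀ {n m} → Graph n m → List (Subset m)
Efix {m = m} G = filter (isFix? G) (allSubsets m)

-- A set F ∈ E_fix(T) can only contain internal edges (both endpoints of degree
-- at least 2), so |E_fix(T)| ≤ 2^k for the number k of internal edges. The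
-- internal edges form a forest with at least L + 1 components (each of the L
-- leaves alone, plus one containing an internal edge), hence L + k < n.
-- Finally a tree has at least Δ leaves: with h v = deg v + [v is a leaf] ≥ 2,
-- the handshake lemma and m ≤ n − 1 give Δ + 2(n − 1) ≤ Σ h = 2m + L ≤ 2(n − 1) + L.

module Submission where

open import Defs
open import Data.Nat using (ℕ; zero; suc; _+_; _*_; _≤_; _<_; _∸_; _^_; z≤n; s≤s; _≤?_)
open import Data.Nat.Properties hiding (_≟_)
open import Data.Bool using (Bool; true; false; not; _∨_; _∧_; if_then_else_)
open import Data.Bool.Properties using (∨-zeroʳ; ∧-zeroʳ; ∧-identityʳ; ∧-conicalˡ; ∧-conicalʳ)
open import Data.Fin using (Fin; zero; suc; _≟_; punchIn)
import Data.Fin.Properties as Fin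
open import Data.Fin.Subset using (Subset)
open import Data.Vec using (_∷_; lookup)
open import Data.Vec.Functional using (removeAt)
open import Data.List using (List; []; _∷_; _++_; map; filter; length)
open import Data.List.Properties using (length-++; length-filter; filter-++; filter-none)
open import Data.List.Relation.Unary.All using (universal)
open import Data.List.Relation.Unary.All.Properties using (map⁺)
open import Data.Product using (_×_; _,_; proj₁; proj₂; ∃; Σ-syntax)
open import Data.Sum using (_⊎_; inj₁; inj₂)
open import Function using (_∘_; id)
open import Level using (Level)
open import Relation.Nullary using (Dec; yes; no; does; ¬_; ⌊_⌋; contradiction)
open import Relation.Nullary.Decidable using (isYes≗does; dec-true; dec-false)
open import Relation.Unary using (Pred; Decidable)
open import Relation.Binary.PropositionalEquality
open import Algebra.Properties.CommutativeMonoid.Sum +-0-commutativeMonoid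
  using (sum-syntax; sum-cong-≗; sum-remove; ∑-comm; ∑-distrib-+)

private variable
  ℓ ℓ′ : Level
  A : Set ℓ′
  k m n : ℕ

isYes-true : (a? : Dec A) → A → ⌊ a? ⌋ ≡ true
isYes-true a? x = trans (isYes≗does a?) (dec-true a? x)

isYes-false : (a? : Dec A) → ¬ A → ⌊ a? ⌋ ≡ false
isYes-false a? ¬x = trans (isYes≗does a?) (dec-false a? ¬x)

isYes-true⇒ : (a? : Dec A) → ⌊ a? ⌋ ≡ true → A
isYes-true⇒ (yes x) _ = x
isYes-true⇒ (no _) ()

indicator : Bool → ℕ
indicator b = if b then 1 else 0

count-cong : {p q : Fin m → Bool} → (∀ i → p i ≡ q i) → count p ≡ count q
count-cong {zero}  p≗q = refl
count-cong {suc m} p≗q = cong₂ _+_ (cong indicator (p≗q zero)) (count-cong (p≗q ∘ suc))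

count-true : ∀ m → count {m} (λ _ → true) ≡ m
count-true zero    = refl
count-true (suc m) = cong suc (count-true m)

count-false : ∀ m → count {m} (λ _ → false) ≡ 0
count-false zero    = refl
count-false (suc m) = count-false m

count≡∑ : (p : Fin m → Bool) → count p ≡ ∑[ i < m ] indicator (p i)
count≡∑ {zero}  p = refl
count≡∑ {suc m} p = cong (indicator (p zero) +_) (count≡∑ (p ∘ suc))

count>0 : (p : Fin m → Bool) {i : Fin m} → p i ≡ true → 0 < count p
count>0 p {zero}  pi rewrite pi = s≤s z≤n
count>0 p {suc i} pi = ≤-trans (count>0 (p ∘ suc) pi) (m≤n+m _ _)

count>0⇒∃ : (p : Fin m → Bool) → 0 < count p → ∃ λ i → p i ≡ true
count>0⇒∃ {suc m} p c>0 with p zero in p0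
... | true  = zero , p0
... | false = let i , pi = count>0⇒∃ (p ∘ suc) c>0 in suc i , pi

count-remove : {p q : Fin m → Bool} (w : Fin m) → p w ≡ true → q w ≡ false →
               (∀ v → v ≢ w → p v ≡ q v) → count p ≡ suc (count q)
count-remove {p = p} {q} zero pw qw p≗q rewrite pw | qw =
  cong suc (count-cong (λ v → p≗q (suc v) λ ()))
count-remove {suc m} {p} {q} (suc w) pw qw p≗q = begin
  indicator (p zero) + count (p ∘ suc)       ≡⟨ cong₂ _+_ (cong indicator (p≗q zero λ ())) tail-eq ⟩
  indicator (q zero) + suc (count (q ∘ suc)) ≡⟨ +-suc _ _ ⟩
  suc (count q)                               ∎
  where
  open ≡-Reasoning
  tail-eq : count (p ∘ suc) ≡ suc (count (q ∘ suc))
  tail-eq = count-remove w pw qw (λ v v≢w → p≗q (suc v) (v≢w ∘ Fin.suc-injective))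

indicator-mono : ∀ {x y} → (x ≡ true → y ≡ true) → indicator x ≤ indicator y
indicator-mono {false} _   = z≤n
indicator-mono {true}  x⇒y rewrite x⇒y refl = ≤-refl

count-mono : {p q : Fin m → Bool} → (∀ i → p i ≡ true → q i ≡ true) → count p ≤ count q
count-mono {zero}  p⇒q = z≤n
count-mono {suc m} p⇒q = +-mono-≤ (indicator-mono (p⇒q zero)) (count-mono (p⇒q ∘ suc))

count-< : {p q : Fin m → Bool} {w : Fin m} → (∀ i → q i ≡ true → p i ≡ true) →
          p w ≡ true → q w ≡ false → count q < count p
count-< {w = zero} q⇒p pw qw rewrite pw | qw = s≤s (count-mono (q⇒p ∘ suc))
count-< {suc m} {p} {q} {suc w} q⇒p pw qw =
  +-mono-≤-< (indicator-mono (q⇒p zero)) (count-< (q⇒p ∘ suc) pw qw)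

Holds : (Fin m → Bool) → Fin m → Set
Holds p i = p i ≡ true

without : (Fin m → Bool) → Fin m → Fin m → Bool
without p e i = p i ∧ not ⌊ i ≟ e ⌋

without-removed : (p : Fin m → Bool) (e : Fin m) → without p e e ≡ false
without-removed p e = trans (cong (λ b → p e ∧ not b) (isYes-true (e ≟ e) refl)) (∧-zeroʳ (p e))

without-⊆ : {p : Fin m → Bool} {e i : Fin m} → without p e i ≡ true → p i ≡ true
without-⊆ {p = p} {i = i} = ∧-conicalˡ (p i) _

without-≢ : {p : Fin m → Bool} {e i : Fin m} → without p e i ≡ true → i ≢ e
without-≢ {p = p} {e} w refl = contradiction (trans (sym (without-removed p e)) w) λ ()

count-without : {p : Fin m → Bool} {e : Fin m} → p e ≡ true → count p ≡ suc (count (without p e))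
count-without {p = p} {e} pe = count-remove e pe (without-removed p e) kept
  where
  kept : ∀ i → i ≢ e → p i ≡ without p e i
  kept i i≢e = sym (trans (cong (λ b → p i ∧ not b) (isYes-false (i ≟ e) i≢e)) (∧-identityʳ (p i)))

∑-const : ∀ n k → ∑[ i < n ] k ≡ n * k
∑-const zero    k = refl
∑-const (suc n) k = cong (k +_) (∑-const n k)

∑-≥ : (f : Fin n → ℕ) → (∀ i → k ≤ f i) → n * k ≤ ∑[ i < n ] f i
∑-≥ {zero}  f k≤f = z≤n
∑-≥ {suc n} f k≤f = +-mono-≤ (k≤f zero) (∑-≥ (f ∘ suc) (k≤f ∘ suc))

length-filter-map : {B : Set} {P : Pred B ℓ} (P? : Decidable P) (f : A → B) (xs : List A) →
                    length (filter P? (map f xs)) ≡ length (filter (P? ∘ f) xs)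
length-filter-map P? f []       = refl
length-filter-map P? f (x ∷ xs) with does (P? (f x))
... | true  = cong suc (length-filter-map P? f xs)
... | false = length-filter-map P? f xs

subsets-bound : (good : Fin m → Bool) {R : Pred (Subset m) ℓ} (R? : Decidable R) →
                (∀ {S} → R S → ∀ i → lookup S i ≡ true → good i ≡ true) →
                length (filter R? (allSubsets m)) ≤ 2 ^ count good
subsets-bound {zero}  good R? R⊆good = length-filter R? _
subsets-bound {suc m} good {R} R? R⊆good = begin
  length (filter R? (map (true ∷_) S ++ map (false ∷_) S))   ≡⟨ halves ⟩
  kept true + kept false                                      ≤⟨ by-head (good zero) refl ⟩
  2 ^ count good                                              ∎
  where
  open ≤-Reasoning
  S : List (Subset m)
  S = allSubsets m
  kept : Bool → ℕ
  kept b = length (filter R? (map (b ∷_) S))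
  halves : length (filter R? (map (true ∷_) S ++ map (false ∷_) S)) ≡ kept true + kept false
  halves = trans (cong length (filter-++ R? (map (true ∷_) S) _)) (length-++ (filter R? (map (true ∷_) S)))
  kept≤ : ∀ b → kept b ≤ 2 ^ count (good ∘ suc)
  kept≤ b = ≤-trans (≤-reflexive (length-filter-map R? (b ∷_) S))
                    (subsets-bound (good ∘ suc) (R? ∘ (b ∷_)) (λ r i → R⊆good r (suc i)))
  kept-true≡0 : good zero ≡ false → kept true ≡ 0
  kept-true≡0 g0 = cong length (filter-none R? (map⁺ (universal
    (λ _ r → contradiction (trans (sym g0) (R⊆good r zero refl)) λ ()) S)))
  by-head : ∀ g → good zero ≡ g → kept true + kept false ≤ 2 ^ (indicator g + count (good ∘ suc))
  by-head true  _  = +-mono-≤ (kept≤ true) (≤-trans (kept≤ false) (m≤m+n _ 0))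
  by-head false g0 rewrite kept-true≡0 g0 = kept≤ false

fixed : (Fin n → Fin n) → Fin n → Bool
fixed c v = ⌊ c v ≟ v ⌋

count-fixed-id : ∀ n → count (fixed {n} id) ≡ n
count-fixed-id n = trans (count-cong {n} (λ v → isYes-true (v ≟ v) refl)) (count-true n)

module _ (c : Fin n → Fin n) (s t : Fin n) where

  redirect : Fin n → Fin n
  redirect x with c x ≟ s
  ... | yes _ = t
  ... | no  _ = c x

  redirect-≡ : ∀ {x} → c x ≡ s → redirect x ≡ t
  redirect-≡ {x} cx≡s with c x ≟ s
  ... | yes _    = refl
  ... | no cx≢s = contradiction cx≡s cx≢s

  redirect-≢ : ∀ {x} → c x ≢ s → redirect x ≡ c x
  redirect-≢ {x} cx≢s with c x ≟ s
  ... | yes cx≡s = contradiction cx≡s cx≢s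
  ... | no _     = refl

  redirect-inv : ∀ {x y} → redirect x ≡ redirect y →
                 c x ≡ c y ⊎ (c x ≡ s × c y ≡ t) ⊎ (c x ≡ t × c y ≡ s)
  redirect-inv {x} {y} eq = cases (c x ≟ s) (c y ≟ s)
    where
    cases : Dec (c x ≡ s) → Dec (c y ≡ s) →
            c x ≡ c y ⊎ (c x ≡ s × c y ≡ t) ⊎ (c x ≡ t × c y ≡ s)
    cases (yes cx≡s) (yes cy≡s) = inj₁ (trans cx≡s (sym cy≡s))
    cases (yes cx≡s) (no cy≢s)  =
      inj₂ (inj₁ (cx≡s , trans (sym (redirect-≢ cy≢s)) (trans (sym eq) (redirect-≡ cx≡s))))
    cases (no cx≢s)  (yes cy≡s) =
      inj₂ (inj₂ (trans (sym (redirect-≢ cx≢s)) (trans eq (redirect-≡ cy≡s)) , cy≡s))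
    cases (no cx≢s)  (no cy≢s)  = inj₁ (trans (sym (redirect-≢ cx≢s)) (trans eq (redirect-≢ cy≢s)))

  module _ (c-idem : ∀ x → c (c x) ≡ c x) (cs≡s : c s ≡ s) (ct≡t : c t ≡ t) (t≢s : t ≢ s) where

    redirect-idem : ∀ x → redirect (redirect x) ≡ redirect x
    redirect-idem x = cases (c x ≟ s)
      where
      open ≡-Reasoning
      cases : Dec (c x ≡ s) → redirect (redirect x) ≡ redirect x
      cases (yes cx≡s) = begin
        redirect (redirect x) ≡⟨ cong redirect (redirect-≡ cx≡s) ⟩
        redirect t            ≡⟨ redirect-≢ (t≢s ∘ trans (sym ct≡t)) ⟩
        c t                   ≡⟨ ct≡t ⟩
        t                     ≡⟨ redirect-≡ cx≡s ⟨
        redirect x            ∎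
      cases (no cx≢s) = begin
        redirect (redirect x) ≡⟨ cong redirect (redirect-≢ cx≢s) ⟩
        redirect (c x)        ≡⟨ redirect-≢ (cx≢s ∘ trans (sym (c-idem x))) ⟩
        c (c x)               ≡⟨ c-idem x ⟩
        c x                   ≡⟨ redirect-≢ cx≢s ⟨
        redirect x            ∎

    count-fixed-redirect : count (fixed c) ≡ suc (count (fixed redirect))
    count-fixed-redirect =
      count-remove s (isYes-true (c s ≟ s) cs≡s) (isYes-false (redirect s ≟ s) t≢s′) agree
      where
      t≢s′ : redirect s ≢ s
      t≢s′ = t≢s ∘ trans (sym (redirect-≡ cs≡s))
      agree : ∀ v → v ≢ s → fixed c v ≡ fixed redirect v
      agree v v≢s = cases (c v ≟ s)
        where
        cases : Dec (c v ≡ s) → fixed c v ≡ fixed redirect v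
        cases (yes cv≡s) = trans (isYes-false (c v ≟ v) (λ cv≡v → v≢s (trans (sym cv≡v) cv≡s)))
                                 (sym (isYes-false (redirect v ≟ v) moved))
          where
          moved : redirect v ≢ v
          moved rv≡v = t≢s (trans (sym ct≡t) (trans (cong c (trans (sym (redirect-≡ cv≡s)) rv≡v)) cv≡s))
        cases (no cv≢s) = cong (λ z → ⌊ z ≟ v ⌋) (sym (redirect-≢ cv≢s))

module _ (G : Graph n m) where

  src tgt : Fin m → Fin n
  src i = proj₁ (ends G i)
  tgt i = proj₂ (ends G i)

  module _ {A : Fin m → Set} where

    reach-trans : ∀ {x y z} → Reach G A x y → Reach G A y z → Reach G A x z
    reach-trans here        s = s
    reach-trans (fwd i a r) s = fwd i a (reach-trans r s)
    reach-trans (bwd i a r) s = bwd i a (reach-trans r s)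

    reach-sym : ∀ {x y} → Reach G A x y → Reach G A y x
    reach-sym here        = here
    reach-sym (fwd i a r) = reach-trans (reach-sym r) (bwd i a here)
    reach-sym (bwd i a r) = reach-trans (reach-sym r) (fwd i a here)

    reach-mono : {B : Fin m → Set} → (∀ i → A i → B i) → ∀ {x y} → Reach G A x y → Reach G B x y
    reach-mono A⊆B here        = here
    reach-mono A⊆B (fwd i a r) = fwd i (A⊆B i a) (reach-mono A⊆B r)
    reach-mono A⊆B (bwd i a r) = bwd i (A⊆B i a) (reach-mono A⊆B r)

    Isolated : Fin n → Set
    Isolated q = ∀ i → A i → src i ≢ q × tgt i ≢ q

    reach-isolated : ∀ {q y} → Isolated q → Reach G A q y → y ≡ q
    reach-isolated iso here        = refl
    reach-isolated iso (fwd i a _) = contradiction refl (proj₁ (iso i a))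
    reach-isolated iso (bwd i a _) = contradiction refl (proj₂ (iso i a))

  IsBridge : Fin m → Set
  IsBridge e = ¬ Reach G (λ i → i ≢ e) (src e) (tgt e)

  incident-src : ∀ i → incident G (src i) i ≡ true
  incident-src i = cong (_∨ ⌊ src i ≟ tgt i ⌋) (isYes-true (src i ≟ src i) refl)

  incident-tgt : ∀ i → incident G (tgt i) i ≡ true
  incident-tgt i = trans (cong (⌊ tgt i ≟ src i ⌋ ∨_) (isYes-true (tgt i ≟ tgt i) refl)) (∨-zeroʳ _)

  deg>0 : {A : Fin m → Set} {u v : Fin n} → v ≢ u → Reach G A v u → 0 < deg G v
  deg>0 v≢u here        = contradiction refl v≢u
  deg>0 v≢u (fwd i _ _) = count>0 (incident G (src i)) (incident-src i)
  deg>0 v≢u (bwd i _ _) = count>0 (incident G (tgt i)) (incident-tgt i)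

  endpoints-count : ∀ i → src i ≢ tgt i → count (λ v → incident G v i) ≡ 2
  endpoints-count i s≢t = begin
    count (λ v → incident G v i)
      ≡⟨ count-remove (src i) (incident-src i) (isYes-false (src i ≟ tgt i) s≢t) not-src ⟩
    suc (count (λ v → ⌊ v ≟ tgt i ⌋))
      ≡⟨ cong suc (count-remove (tgt i) (isYes-true (tgt i ≟ tgt i) refl) refl not-tgt) ⟩
    2 + count {n} (λ _ → false)
      ≡⟨ cong (2 +_) (count-false n) ⟩
    2 ∎
    where
    open ≡-Reasoning
    not-src : ∀ v → v ≢ src i → incident G v i ≡ ⌊ v ≟ tgt i ⌋
    not-src v v≢s = cong (_∨ ⌊ v ≟ tgt i ⌋) (isYes-false (v ≟ src i) v≢s)
    not-tgt : ∀ v → v ≢ tgt i → ⌊ v ≟ tgt i ⌋ ≡ false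
    not-tgt v v≢t = isYes-false (v ≟ tgt i) v≢t

  handshake : (∀ i → src i ≢ tgt i) → ∑[ v < n ] deg G v ≡ m * 2
  handshake loopless = begin
    ∑[ v < n ] deg G v                              ≡⟨ sum-cong-≗ (count≡∑ ∘ incident G) ⟩
    ∑[ v < n ] ∑[ i < m ] indicator (incident G v i) ≡⟨ ∑-comm (λ v i → indicator (incident G v i)) ⟩
    ∑[ i < m ] ∑[ v < n ] indicator (incident G v i) ≡⟨ sum-cong-≗ two-ends ⟩
    ∑[ i < m ] 2                                    ≡⟨ ∑-const m 2 ⟩
    m * 2                                           ∎
    where
    open ≡-Reasoning
    two-ends : ∀ i → ∑[ v < n ] indicator (incident G v i) ≡ 2
    two-ends i = trans (sym (count≡∑ (λ v → incident G v i))) (endpoints-count i (loopless i))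

  tree-bridge : IsTree G → ∀ e → IsBridge e
  tree-bridge (_ , connected , minimal) e r = minimal e (λ u v → avoid-e (connected u v))
    where
    avoid-e : ∀ {u v} → Reach G (λ _ → ⊤') u v → Reach G (λ i → i ≢ e) u v
    avoid-e here = here
    avoid-e (fwd i _ s) with i ≟ e
    ... | yes refl = reach-trans r (avoid-e s)
    ... | no  i≢e  = fwd i i≢e (avoid-e s)
    avoid-e (bwd i _ s) with i ≟ e
    ... | yes refl = reach-trans (reach-sym r) (avoid-e s)
    ... | no  i≢e  = bwd i i≢e (avoid-e s)

  tree-loopless : IsTree G → ∀ e → src e ≢ tgt e
  tree-loopless tree e s≡t = tree-bridge tree e (subst (Reach G _ (src e)) s≡t here)

  record Components (A : Fin m → Set) : Set where
    field
      rep       : Fin n → Fin n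
      rep-idem  : ∀ x → rep (rep x) ≡ rep x
      rep-reach : ∀ {x y} → rep x ≡ rep y → Reach G A x y

    rep-isolated : ∀ {q y} → Isolated q → rep y ≡ rep q → y ≡ q
    rep-isolated iso eq = reach-isolated iso (reach-sym (rep-reach eq))

  open Components

  discrete : ∀ A → Components A
  discrete A = record { rep = id ; rep-idem = λ _ → refl ; rep-reach = λ { refl → here } }

  join : ∀ {A B} (C : Components A) e → (∀ i → A i → B i) → B e → rep C (src e) ≢ rep C (tgt e) →
         Σ[ C′ ∈ Components B ] count (fixed (rep C)) ≡ suc (count (fixed (rep C′)))
  join {A} {B} C e A⊆B Be ra≢rb =
    C′ , count-fixed-redirect c (c b) (c a) c-idem (c-idem b) (c-idem a) ra≢rb
    where
    c : Fin n → Fin n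
    c = rep C
    c-idem : ∀ x → c (c x) ≡ c x
    c-idem = rep-idem C
    a b : Fin n
    a = src e
    b = tgt e
    c′ : Fin n → Fin n
    c′ = redirect c (c b) (c a)
    widen : ∀ {x y} → Reach G A x y → Reach G B x y
    widen = reach-mono A⊆B
    reach : ∀ {x y} → c′ x ≡ c′ y → Reach G B x y
    reach eq with redirect-inv c (c b) (c a) eq
    ... | inj₁ cx≡cy                  = widen (rep-reach C cx≡cy)
    ... | inj₂ (inj₁ (cx≡cb , cy≡ca)) =
      reach-trans (widen (rep-reach C cx≡cb)) (bwd e Be (widen (rep-reach C (sym cy≡ca))))
    ... | inj₂ (inj₂ (cx≡ca , cy≡cb)) =
      reach-trans (widen (rep-reach C cx≡ca)) (fwd e Be (widen (rep-reach C (sym cy≡cb))))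
    C′ : Components B
    C′ = record
      { rep       = c′
      ; rep-idem  = redirect-idem c (c b) (c a) c-idem (c-idem b) (c-idem a) ra≢rb
      ; rep-reach = reach
      }

  -- Adding a bridge joins two distinct classes, so it removes exactly one representative.
  forest-components : ∀ k (P : Fin m → Bool) → count P ≡ k → (∀ e → P e ≡ true → IsBridge e) →
                      Σ[ C ∈ Components (Holds P) ] count (fixed (rep C)) + k ≡ n
  forest-components zero    P _ _ =
    discrete _ , trans (+-identityʳ _) (count-fixed-id n)
  forest-components (suc k) P #P bridges = C′ , (begin
      count (fixed (rep C′)) + suc k   ≡⟨ +-suc _ k ⟩
      suc (count (fixed (rep C′)) + k) ≡⟨ cong (_+ k) fewer-roots ⟨
      count (fixed (rep C)) + k        ≡⟨ proj₂ components ⟩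
      n                                ∎)
    where
    open ≡-Reasoning
    edge : ∃ λ e → P e ≡ true
    edge = count>0⇒∃ P (subst (0 <_) (sym #P) (s≤s z≤n))
    e : Fin m
    e = proj₁ edge
    P′ : Fin m → Bool
    P′ = without P e
    P′⊆P : ∀ i → Holds P′ i → Holds P i
    P′⊆P _ = without-⊆ {p = P}
    components : Σ[ C ∈ Components (Holds P′) ] count (fixed (rep C)) + k ≡ n
    components = forest-components k P′ (suc-injective (trans (sym (count-without {p = P} (proj₂ edge))) #P))
                                   (λ i → bridges i ∘ P′⊆P i)
    C : Components (Holds P′)
    C = proj₁ components
    separated : rep C (src e) ≢ rep C (tgt e)
    separated eq = bridges e (proj₂ edge) (reach-mono (λ _ → without-≢ {p = P}) (rep-reach C eq))
    joined : Σ[ C′ ∈ Components (Holds P) ] count (fixed (rep C)) ≡ suc (count (fixed (rep C′)))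
    joined = join C e P′⊆P (proj₂ edge) separated
    C′ : Components (Holds P)
    C′ = proj₁ joined
    fewer-roots : count (fixed (rep C)) ≡ suc (count (fixed (rep C′)))
    fewer-roots = proj₂ joined

  forest-bound : (P : Fin m → Bool) (Q : Fin n → Bool) (v : Fin n) →
                 (∀ e → P e ≡ true → IsBridge e) → (∀ q → Q q ≡ true → Isolated {Holds P} q) →
                 Q v ≡ false → count Q + count P < n
  forest-bound P Q v bridges isolated Qv≡false = begin-strict
      count Q + count P                 <⟨ +-monoˡ-< (count P) (count-< Q⊆roots rv-root Q[rv]≡false) ⟩
      count (fixed (rep C)) + count P   ≡⟨ proj₂ components ⟩
      n                                 ∎
    where
    open ≤-Reasoning
    components : Σ[ C ∈ Components (Holds P) ] count (fixed (rep C)) + count P ≡ n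
    components = forest-components (count P) P refl bridges
    C : Components (Holds P)
    C = proj₁ components
    r : Fin n → Fin n
    r = rep C
    rv-root : fixed r (r v) ≡ true
    rv-root = isYes-true (r (r v) ≟ r v) (rep-idem C v)
    Q⊆roots : ∀ q → Q q ≡ true → fixed r q ≡ true
    Q⊆roots q Qq = isYes-true (r q ≟ q) (rep-isolated C (isolated q Qq) (rep-idem C q))
    Q[rv]≡false : Q (r v) ≡ false
    Q[rv]≡false with Q (r v) in Qrv
    ... | false = refl
    ... | true  = contradiction (trans (sym Qv≡false) (trans (cong Q v≡rv) Qrv)) λ ()
      where
      v≡rv : v ≡ r v
      v≡rv = rep-isolated C (isolated _ Qrv) (sym (rep-idem C v))

  tree-edges : IsTree G → Fin n → m < n
  tree-edges tree v = subst₂ (λ x y → x + y < n) (count-false n) (count-true m)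
    (forest-bound (λ _ → true) (λ _ → false) v (λ e _ → tree-bridge tree e) (λ _ ()) refl)

leaf : Graph n m → Fin n → Bool
leaf G v = ⌊ deg G v ≤? 1 ⌋

internal : Graph n m → Fin m → Bool
internal G i = ⌊ 2 ≤? deg G (src G i) ⌋ ∧ ⌊ 2 ≤? deg G (tgt G i) ⌋

internal-src : (G : Graph n m) {i : Fin m} → internal G i ≡ true → 2 ≤ deg G (src G i)
internal-src G {i} int = isYes-true⇒ (2 ≤? deg G (src G i)) (∧-conicalˡ _ _ int)

internal-tgt : (G : Graph n m) {i : Fin m} → internal G i ≡ true → 2 ≤ deg G (tgt G i)
internal-tgt G {i} int = isYes-true⇒ (2 ≤? deg G (tgt G i)) (∧-conicalʳ _ _ int)

deg≥2⇒¬leaf : (G : Graph n m) (v : Fin n) → 2 ≤ deg G v → leaf G v ≡ false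
deg≥2⇒¬leaf G v 2≤deg = isYes-false (deg G v ≤? 1) (<⇒≱ 2≤deg)

leaves-isolated : (G : Graph n m) (q : Fin n) → leaf G q ≡ true → Isolated G {Holds (internal G)} q
leaves-isolated G q leaf-q i int = ≢q (internal-src G int) , ≢q (internal-tgt G int)
  where
  ≢q : ∀ {v} → 2 ≤ deg G v → v ≢ q
  ≢q 2≤deg refl = contradiction (trans (sym (deg≥2⇒¬leaf G q 2≤deg)) leaf-q) λ ()

maxDegree≤leaves : {G : Graph n m} → IsTree G → (∀ v → 0 < deg G v) → ∀ w → deg G w ≤ count (leaf G)
maxDegree≤leaves {suc n} {m} {G} tree deg-pos w = +-cancelʳ-≤ (n * 2) _ _ (begin
    deg G w + n * 2                   ≤⟨ +-mono-≤ (m≤m+n _ _) (∑-≥ (removeAt h w) (h≥2 ∘ punchIn w)) ⟩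
    h w + ∑[ i < n ] removeAt h w i   ≡⟨ sum-remove {i = w} h ⟨
    ∑[ v < suc n ] h v                ≡⟨ ∑-distrib-+ (deg G) (indicator ∘ leaf G) ⟩
    ∑[ v < suc n ] deg G v + ∑[ v < suc n ] indicator (leaf G v)
      ≡⟨ cong₂ _+_ (handshake G (tree-loopless G tree)) (sym (count≡∑ (leaf G))) ⟩
    m * 2 + count (leaf G)            ≤⟨ +-monoˡ-≤ _ (*-monoˡ-≤ 2 (≤-pred (tree-edges G tree w))) ⟩
    n * 2 + count (leaf G)            ≡⟨ +-comm (n * 2) _ ⟩
    count (leaf G) + n * 2            ∎)
  where
  open ≤-Reasoning
  h : Fin (suc n) → ℕ
  h v = deg G v + indicator (leaf G v)
  h≥2 : ∀ v → 2 ≤ h v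
  h≥2 v with deg G v ≤? 1
  ... | yes _   = +-monoˡ-≤ 1 (deg-pos v)
  ... | no  d≰1 = ≤-trans (≰⇒> d≰1) (m≤m+n _ 0)

isFix⇒internal : (G : Graph n m) {S : Subset m} → IsFix G S →
                 ∀ i → lookup S i ≡ true → internal G i ≡ true
isFix⇒internal G {S} fix i Si =
  cong₂ _∧_ (endpoint-deg≥2 (src G i) (incident-src G i)) (endpoint-deg≥2 (tgt G i) (incident-tgt G i))
  where
  endpoint-deg≥2 : ∀ v → incident G v i ≡ true → ⌊ 2 ≤? deg G v ⌋ ≡ true
  endpoint-deg≥2 v inc = isYes-true (2 ≤? deg G v)
    (≤-trans (*-monoʳ-≤ 2 (count>0 (λ j → lookup S j ∧ incident G v j) (cong₂ _∧_ Si inc))) (fix v))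

Efix≤2^internal : (G : Graph n m) → length (Efix G) ≤ 2 ^ count (internal G)
Efix≤2^internal G = subsets-bound (internal G) (isFix? G) (λ {S} → isFix⇒internal G {S})

maxDegree+internal<n : {G : Graph n m} → IsTree G → ∀ {e} → internal G e ≡ true →
                       ∀ w → deg G w + count (internal G) < n
maxDegree+internal<n {n} {G = G} tree@(_ , connected , _) {e} int w = begin-strict
  deg G w + count (internal G)         ≤⟨ +-monoˡ-≤ _ (maxDegree≤leaves tree degrees>0 w) ⟩
  count (leaf G) + count (internal G)  <⟨ forest-bound G (internal G) (leaf G) (src G e)
                                            (λ i _ → tree-bridge G tree i) (leaves-isolated G) src-not-leaf ⟩
  n                                    ∎
  where
  open ≤-Reasoning
  src-not-leaf : leaf G (src G e) ≡ false
  src-not-leaf = deg≥2⇒¬leaf G (src G e) (internal-src G int)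
  src≢tgt : src G e ≢ tgt G e
  src≢tgt = tree-loopless G tree e
  degrees>0 : ∀ v → 0 < deg G v
  degrees>0 v with v ≟ src G e
  ... | yes refl  = deg>0 G src≢tgt (connected v (tgt G e))
  ... | no  v≢src = deg>0 G v≢src (connected v (src G e))

m+n<o⇒n≤o∸m∸1 : ∀ m {n o} → m + n < o → n ≤ o ∸ m ∸ 1
m+n<o⇒n≤o∸m∸1 m {n} {o} m+n<o =
  subst (n ≤_) (sym (∸-+-assoc o m 1)) (m+n≤o⇒m≤o∸n n (subst (_≤ o) reorder m+n<o))
  where
  reorder : suc (m + n) ≡ n + (m + 1)
  reorder = trans (cong suc (+-comm m n)) (sym (trans (cong (n +_) (+-comm m 1)) (+-suc n m)))

count-internal≤ : {G : Graph n m} {Δ : ℕ} → IsTree G → IsMaxDegree G Δ →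
                  count (internal G) ≤ n ∸ Δ ∸ 1
count-internal≤ {G = G} tree (_ , w , deg-w≡Δ) with count (internal G) in #internal
... | zero  = z≤n
... | suc k = m+n<o⇒n≤o∸m∸1 _
  (subst₂ (λ d c → d + c < _) deg-w≡Δ #internal (maxDegree+internal<n tree (proj₂ some-internal) w))
  where
  some-internal : ∃ λ e → internal G e ≡ true
  some-internal = count>0⇒∃ (internal G) (subst (0 <_) (sym #internal) (s≤s z≤n))

lemma4 : ∀ {n m} (T : Graph n m) (Δ : ℕ) → IsTree T → IsMaxDegree T Δ →
    length (Efix T) ≤ 2 ^ (n ∸ Δ ∸ 1)
lemma4 T Δ tree maxDegree = ≤-trans (Efix≤2^internal T) (^-monoʳ-≤ 2 (count-internal≤ tree maxDegree))
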